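{- (i) Let $\sigma$ be a finite sequence of channel actions and $x\in\Sigma^*$. There exists an infinite sequence $x=x_0\xrightarrow{\sigma}x_1\xrightarrow{\sigma}x_2\xrightarrow{\sigma}\cdots$ if and only if $\mathrm{pr}[\sigma^\omega](\epsilon)\neq\bot$ and $\mathrm{pr}[\sigma^\omega](\epsilon)\sqsubseteq x$. (ii) Let $S$ be a flat single-channel LCM, $(q,x)$ a configuration and $q'$ a location. There exists an infinite run of $S$ starting from $(q,x)$ that visits $q'$ infinitely many times if and only if $q'$ lies on an elementary cycle of $S$, $\mathrm{pr}[\sigma_{q'}^\omega](\epsilon)\neq\bot$, and $(q,x)\xrightarrow{*}(q',\mathrm{pr}[\sigma_{q'}^\omega](\epsilon))$.
   Context: An LCM is $S=\langle Q,\Sigma,\Delta\rangle$ with $\Delta\subseteq Q\times(\{!,?\}\times\Sigma^*)\times Q$; channel actions are $!w$, $?w$. Lossy semantics: $x\xrightarrow{!w}y$ iff $y\sqsubseteq xw$, $x\xrightarrow{?w}y$ iff $wy\sqsubseteq x$ ($\sqsubseteq$ scattered subword), extended to sequences; configurations $(q,x)$ step via rules $\langle q,\theta,q''\rangle$ with $x\xrightarrow{\theta}y$. Elementary cycle: nonempty set of rules $\{\langle p_i,\theta_i,q_i\rangle\}_{i=1}^m$ with $q_m=p_1$, $p_i=q_{i-1}$, $p_i$ distinct. $S$ is flat if no location is visited by two different elementary cycles; then $\sigma_{q}$ is the action sequence along the unique cycle through $q$, starting with the action leaving $q$ ($\epsilon$ if none). $\uparrow y=\{z:y\sqsubseteq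 z\}$, $\mathrm{Pre}[\sigma](T)=\{z:\exists t\in T,\ z\xrightarrow{\sigma}t\}$, $I_\sigma=\bigcap_{k\in\mathbb{N}}\mathrm{Pre}[\sigma^k](\Sigma^*)$ (empty or $\uparrow y$ for a unique $y$); $\mathrm{pr}[\sigma^\omega](\epsilon)=y$ if $I_\sigma=\uparrow y$ and $=\bot$ if $I_\sigma=\emptyset$. -}

module Defs where

open import Data.Nat using (ℕ; zero; suc; _≤_)
open import Data.Fin using (Fin)
open import Data.List using (List; []; _∷_; _++_; concat; replicate; map)
open import Data.Maybe using (Maybe; just; nothing)
open import Data.Product using (Σ; ∃; ∃-syntax; _×_; _,_; proj₁)
open import Data.List.Relation.Binary.Sublist.Propositional using (_⊆_)
open import Data.List.Relation.Unary.All using (All)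
open import Data.List.Relation.Unary.Linked using (Linked)
open import Data.List.Relation.Unary.Unique.Propositional using (Unique)
open import Data.List.Membership.Propositional using (_∈_)
open import Relation.Nullary using (¬_)
open import Relation.Binary.PropositionalEquality using (_≡_)
open import Relation.Binary.Construct.Closure.ReflexiveTransitive using (Star)

-- Alphabet Σ = Fin k (a finite alphabet); words are lists; scattered
-- subword ⊑ is the stdlib sublist relation _⊆_.

data Action (k : ℕ) : Set where
  send : List (Fin k) → Action k
  recv : List (Fin k) → Action k

ChanStep : ∀ {k} → Action k → List (Fin k) → List (Fin k) → Set
ChanStep (send w) x y = y ⊆ (x ++ w)
ChanStep (recv w) x y = (w ++ y) ⊆ x

data Steps {k : ℕ} : List (Action k) → List (Fin k) → List (Fin k) → Set where
  []  : ∀ {x} → Steps [] x x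
  _∷_ : ∀ {θ σ x y z} → ChanStep θ x y → Steps σ y z → Steps (θ ∷ σ) x z

pow : ∀ {k} → List (Action k) → ℕ → List (Action k)
pow σ m = concat (replicate m σ)

PreAll : ∀ {k} → List (Action k) → List (Fin k) → Set
PreAll σ z = ∃[ t ] Steps σ z t

Iσ : ∀ {k} → List (Action k) → List (Fin k) → Set
Iσ σ z = ∀ m → PreAll (pow σ m) z

-- IsPr σ p : p is pr[σ^ω](ε), with nothing = ⊥.
--   p = just y  iff  I_σ = ↑y ;  p = nothing  iff  I_σ = ∅.
IsPr : ∀ {k} → List (Action k) → Maybe (List (Fin k)) → Set
IsPr σ nothing  = ∀ z → ¬ Iσ σ z
IsPr σ (just y) = ∀ z → (Iσ σ z → y ⊆ z) × (y ⊆ z → Iσ σ z)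

InfSeq : ∀ {k} → List (Action k) → List (Fin k) → Set
InfSeq {k} σ x = Σ (ℕ → List (Fin k)) λ f → (f 0 ≡ x) × (∀ i → Steps σ (f i) (f (suc i)))

Rule : ℕ → ℕ → Set
Rule k n = Fin n × Action k × Fin n

src : ∀ {k n} → Rule k n → Fin n
src (p , _ , _) = p

act : ∀ {k n} → Rule k n → Action k
act (_ , θ , _) = θ

tgt : ∀ {k n} → Rule k n → Fin n
tgt (_ , _ , q) = q

lastOf : ∀ {a} {A : Set a} → A → List A → A
lastOf r []       = r
lastOf r (s ∷ rs) = lastOf s rs

Config : ℕ → ℕ → Set
Config k n = Fin n × List (Fin k)

data Step {k n : ℕ} (Δ : List (Rule k n)) : Config k n → Config k n → Set where
  step : ∀ {p θ p'' x y} → (p , θ , p'') ∈ Δ → ChanStep θ x y → Step Δ (p , x) (p'' , y)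

Reach : ∀ {k n} → List (Rule k n) → Config k n → Config k n → Set
Reach Δ = Star (Step Δ)

record ElemCycle {k n : ℕ} (Δ : List (Rule k n)) (r : Rule k n) (rs : List (Rule k n)) : Set where
  field
    inΔ      : All (_∈ Δ) (r ∷ rs)
    linked   : Linked (λ a b → tgt a ≡ src b) (r ∷ rs)
    closes   : tgt (lastOf r rs) ≡ src r
    distinct : Unique (map src (r ∷ rs))

-- Flatness: no location is visited by two different elementary cycles
-- (cycles are sets of rules; different = different as sets).
Flat : ∀ {k n} → List (Rule k n) → Set
Flat {k} {n} Δ = ∀ r rs r' rs' → ElemCycle Δ r rs → ElemCycle Δ r' rs' →
  ∀ (p : Fin n) → p ∈ map src (r ∷ rs) → p ∈ map src (r' ∷ rs') →
  ∀ (ρ : Rule k n) → (ρ ∈ (r ∷ rs) → ρ ∈ (r' ∷ rs')) × (ρ ∈ (r' ∷ rs') → ρ ∈ (r ∷ rs))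

ElemCycleAt : ∀ {k n} → List (Rule k n) → Fin n → Rule k n → List (Rule k n) → Set
ElemCycleAt Δ q r rs = ElemCycle Δ r rs × src r ≡ q

cycleWord : ∀ {k n} → Rule k n → List (Rule k n) → List (Action k)
cycleWord r rs = map act (r ∷ rs)

InfRunVisiting : ∀ {k n} → List (Rule k n) → Config k n → Fin n → Set
InfRunVisiting {k} {n} Δ c q' =
  Σ (ℕ → Config k n) λ f → (f 0 ≡ c) × (∀ i → Step Δ (f i) (f (suc i)))
    × (∀ i → ∃[ j ] (i ≤ j × proj₁ (f j) ≡ q'))

-- Sending has a ⊑-greatest successor (append) and so has receiving (match greedily and keep
-- the rest), and Steps σ is monotone in its source. Hence I_σ is closed under the greatest
-- σ-successor, and iterating it from any x ∈ I_σ gives an infinite σ-sequence; conversely an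
-- infinite σ-sequence from x puts x in every Pre[σ^m](Σ*). This is (i); moreover y = pr[σ^ω](ε)
-- lies below its own greatest σ-successor, so losing letters gives y →σ y.
--
-- For (ii), cut a run visiting q' infinitely often at its consecutive visits of q'. Each
-- excursion is a closed walk returning to q' only at its end, and in a flat system such a walk
-- is an elementary cycle: otherwise it contains an inner elementary cycle, which shares a
-- location with the shortened outer walk (an elementary cycle by induction), so by flatness the
-- first rule of the excursion, leaving q', would lie on the inner cycle, which avoids q'.
-- Flatness also makes the elementary cycle through q' unique, so the channel contents at the
-- visits form an infinite σ_{q'}-sequence, and (i) gives the configuration (q', pr[σ_{q'}^ω](ε)).
-- Conversely, the loop y →σ y closes a lasso.

module Submission where

open import Defs
open import Data.Nat using (ℕ; zero; suc; _+_; _∸_; _≤_; _<_; z≤n; s≤s)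
open import Data.Nat.Properties using (≤-refl; ≤-trans; +-suc; m∸n+n≡m)
open import Data.Nat.GeneralisedArithmetic using (iterate)
open import Data.Fin using (Fin)
open import Data.Fin.Properties using (_≟_)
open import Data.List using (List; []; _∷_; _++_; map; length)
open import Data.List.Properties using (map-++; length-++-≤ʳ)
open import Data.Maybe using (Maybe; just; nothing)
open import Data.Product using (Σ; ∃-syntax; _×_; _,_; proj₁; proj₂)
open import Data.Sum using (_⊎_; inj₁; inj₂)
open import Data.Empty using (⊥-elim)
open import Data.List.Relation.Binary.Sublist.Propositional
  using (_⊆_; _∷ʳ_; _∷_; ⊆-refl; ⊆-trans)
import Data.List.Relation.Binary.Sublist.Propositional.Properties as Sublist
open import Data.List.Relation.Unary.All using (All; []; _∷_)
import Data.List.Relation.Unary.All as All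
open import Data.List.Relation.Unary.All.Properties using (¬Any⇒All¬; ++⁻ˡ; ++⁻ʳ; ++⁺; map⁻)
open import Data.List.Relation.Unary.Any using (here; there)
open import Data.List.Relation.Unary.Linked using (Linked; [-]; _∷_)
open import Data.List.Relation.Unary.Unique.Propositional using (Unique; []; _∷_)
open import Data.List.Membership.Propositional using (_∈_; _∉_)
open import Data.List.Membership.Propositional.Properties using (∈-map⁺; ∈-++⁺ˡ; ∈-++⁺ʳ)
import Data.List.Membership.DecPropositional as DecMembership
open import Relation.Binary.Construct.Closure.ReflexiveTransitive using (Star; ε; _◅_; _◅◅_)
open import Relation.Nullary using (¬_; yes; no)
open import Relation.Unary using (Decidable)
open import Relation.Binary.PropositionalEquality
  using (_≡_; _≢_; refl; sym; trans; cong; subst; subst₂)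

private
  variable
    k n : ℕ
    a : Fin k
    p q m : Fin n
    t t′ u v w x y z z′ : List (Fin k)
    θ : Action k
    σ τ : List (Action k)
    π : Maybe (List (Fin k))
    A : Set
    Δ C W W′ rs rs′ : List (Rule k n)
    ρ r r′ : Rule k n

least-witness : {P : ℕ → Set} → Decidable P → ∀ d → P d → ∃[ e ] (P e × (∀ {u} → u < e → ¬ P u))
least-witness P? zero p = 0 , p , λ ()
least-witness P? (suc d) p with P? 0
... | yes p₀ = 0 , p₀ , λ ()
... | no ¬p₀ =
  let e , pe , below = least-witness (λ u → P? (suc u)) d p
  in suc e , pe , λ { {zero} _ → ¬p₀ ; {suc u} (s≤s u<e) → below u<e }

Unique-++⁻ˡ : ∀ (xs : List A) {ys} → Unique (xs ++ ys) → Unique xs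
Unique-++⁻ˡ [] _ = []
Unique-++⁻ˡ (x ∷ xs) (x∉ ∷ distinct) = ++⁻ˡ xs x∉ ∷ Unique-++⁻ˡ xs distinct

module _ {A : Set} {R : A → A → Set} {a c c₁ : A} where

  lasso : Star R a c → R c c₁ → Star R c₁ c →
          Σ (ℕ → A) λ g → g 0 ≡ a × (∀ i → R (g i) (g (suc i)))
                            × (∀ i → ∃[ j ] (i ≤ j × g j ≡ c))
  lasso stem edge loop = (λ i → proj₁ (iterate next (a , stem) i)) , refl ,
                         steps (a , stem) , visits (a , stem)
    where
    Pending : Set
    Pending = Σ A λ d → Star R d c
    next : Pending → Pending
    next (_ , ε)        = c₁ , loop
    next (_ , _ ◅ rest) = _ , rest
    next-step : ∀ s → R (proj₁ s) (proj₁ (next s))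
    next-step (_ , ε)     = edge
    next-step (_ , r ◅ _) = r
    steps : ∀ s i → R (proj₁ (iterate next s i)) (proj₁ (iterate next s (suc i)))
    steps s zero    = next-step s
    steps s (suc i) = steps (next s) i
    arrives : ∀ {d} (rest : Star R d c) → ∃[ j ] proj₁ (iterate next (d , rest) j) ≡ c
    arrives ε          = 0 , refl
    arrives (_ ◅ rest) = let j , e = arrives rest in suc j , e
    visits : ∀ s i → ∃[ j ] (i ≤ j × proj₁ (iterate next s j) ≡ c)
    visits s zero    = let j , e = arrives (proj₂ s) in j , z≤n , e
    visits s (suc i) = let j , i≤j , e = visits (next s) i in suc j , s≤s i≤j , e

after : Fin k → List (Fin k) → List (Fin k)
after a [] = []
after a (b ∷ z) with a ≟ b
... | yes _ = z
... | no  _ = after a z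

after-sound : a ∷ t ⊆ z → a ∷ after a z ⊆ z
after-sound {a = a} {z = b ∷ z} le with a ≟ b
after-sound _           | yes refl = refl ∷ ⊆-refl
after-sound (b ∷ʳ le)   | no _     = b ∷ʳ after-sound le
after-sound (refl ∷ le) | no a≢b   = ⊥-elim (a≢b refl)

after-greatest : a ∷ t ⊆ z → t ⊆ after a z
after-greatest {a = a} {z = b ∷ z} le with a ≟ b
after-greatest (b ∷ʳ le)   | yes refl = Sublist.∷ˡ⁻ le
after-greatest (_ ∷ le)    | yes refl = le
after-greatest (b ∷ʳ le)   | no _     = after-greatest le
after-greatest (refl ∷ le) | no a≢b   = ⊥-elim (a≢b refl)

receive : List (Fin k) → List (Fin k) → List (Fin k)
receive [] z = z
receive (a ∷ w) z = receive w (after a z)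

receive-sound : ∀ w → w ++ t ⊆ z → w ++ receive w z ⊆ z
receive-sound [] le = ⊆-refl
receive-sound (a ∷ w) le =
  ⊆-trans (refl ∷ receive-sound w (after-greatest le)) (after-sound le)

receive-greatest : ∀ w → w ++ t ⊆ z → t ⊆ receive w z
receive-greatest [] le = le
receive-greatest (a ∷ w) le = receive-greatest w (after-greatest le)

-- The ⊑-greatest θ-successor of z, provided z has a θ-successor at all.
post : Action k → List (Fin k) → List (Fin k)
post (send w) z = z ++ w
post (recv w) z = receive w z

post-step : ChanStep θ z t → ChanStep θ z (post θ z)
post-step {θ = send w} _ = ⊆-refl
post-step {θ = recv w} = receive-sound w

post-greatest : ChanStep θ z t → t ⊆ post θ z
post-greatest {θ = send w} le = le
post-greatest {θ = recv w} = receive-greatest w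

ChanStep-mono : z ⊆ z′ → ChanStep θ z t → ChanStep θ z′ t
ChanStep-mono {θ = send w} z⊆z′ st = ⊆-trans st (Sublist.++⁺ z⊆z′ ⊆-refl)
ChanStep-mono {θ = recv w} z⊆z′ st = ⊆-trans st z⊆z′

ChanStep-lossy : t′ ⊆ t → ChanStep θ z t → ChanStep θ z t′
ChanStep-lossy {θ = send w} t′⊆t st = ⊆-trans t′⊆t st
ChanStep-lossy {θ = recv w} t′⊆t st = ⊆-trans (Sublist.++⁺ (⊆-refl {x = w}) t′⊆t) st

posts : List (Action k) → List (Fin k) → List (Fin k)
posts [] z = z
posts (θ ∷ σ) z = posts σ (post θ z)

Steps-mono : z ⊆ z′ → Steps σ z t → ∃[ t′ ] (t ⊆ t′ × Steps σ z′ t′)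
Steps-mono z⊆z′ [] = _ , z⊆z′ , []
Steps-mono z⊆z′ (st ∷ sts) = _ , ⊆-refl , ChanStep-mono z⊆z′ st ∷ sts

Steps-lossy : t′ ⊆ t → Steps (θ ∷ σ) z t → Steps (θ ∷ σ) z t′
Steps-lossy t′⊆t (st ∷ []) = ChanStep-lossy t′⊆t st ∷ []
Steps-lossy t′⊆t (st ∷ sts@(_ ∷ _)) = st ∷ Steps-lossy t′⊆t sts

Steps-posts : Steps σ z t → Steps σ z (posts σ z) × t ⊆ posts σ z
Steps-posts [] = [] , ⊆-refl
Steps-posts (st ∷ sts) =
  let t′ , t⊆t′ , sts′ = Steps-mono (post-greatest st) sts
      sts″ , t′⊆ = Steps-posts sts′
  in post-step st ∷ sts″ , ⊆-trans t⊆t′ t′⊆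

Steps-++ : Steps σ x y → Steps τ y z → Steps (σ ++ τ) x z
Steps-++ [] sts = sts
Steps-++ (st ∷ sts) sts′ = st ∷ Steps-++ sts sts′

Steps-split : ∀ σ → Steps (σ ++ τ) x z → ∃[ y ] (Steps σ x y × Steps τ y z)
Steps-split [] sts = _ , [] , sts
Steps-split (θ ∷ σ) (st ∷ sts) =
  let y , sts₁ , sts₂ = Steps-split σ sts in y , st ∷ sts₁ , sts₂

PreAll-mono : z ⊆ z′ → PreAll σ z → PreAll σ z′
PreAll-mono z⊆z′ (t , sts) = let t′ , _ , sts′ = Steps-mono z⊆z′ sts in t′ , sts′

Iσ-posts : Iσ σ z → Steps σ z (posts σ z) × Iσ σ (posts σ z)
Iσ-posts {σ = σ} {z = z} I =
  proj₁ (Steps-posts (proj₁ (proj₂ (first-round 0)))) ,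
  λ m → let _ , sts , rest = first-round m in PreAll-mono (proj₂ (Steps-posts sts)) rest
  where
  first-round : ∀ m → ∃[ y ] (Steps σ z y × PreAll (pow σ m) y)
  first-round m = let t , sts = I (suc m)
                      y , sts₁ , sts₂ = Steps-split σ sts
                  in y , sts₁ , t , sts₂

Iσ⇒InfSeq : Iσ σ x → InfSeq σ x
Iσ⇒InfSeq {σ = σ} {x = x} I = iterate (posts σ) x , refl , λ i → steps i I
  where
  steps : ∀ i → Iσ σ z → Steps σ (iterate (posts σ) z i) (iterate (posts σ) z (suc i))
  steps zero    I = proj₁ (Iσ-posts I)
  steps (suc i) I = steps i (proj₂ (Iσ-posts I))

InfSeq⇒Iσ : InfSeq σ x → Iσ σ x
InfSeq⇒Iσ (g , refl , sts) zero = _ , []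
InfSeq⇒Iσ (g , refl , sts) (suc m) =
  let t , sts′ = InfSeq⇒Iσ ((λ i → g (suc i)) , refl , (λ i → sts (suc i))) m
  in t , Steps-++ (sts 0) sts′

InfSeq⇒pr-⊆ : IsPr σ π → InfSeq σ x → ∃[ y ] (π ≡ just y × y ⊆ x)
InfSeq⇒pr-⊆ {π = nothing} none inf = ⊥-elim (none _ (InfSeq⇒Iσ inf))
InfSeq⇒pr-⊆ {π = just y} up inf = y , refl , proj₁ (up _) (InfSeq⇒Iσ inf)

pr-⊆⇒InfSeq : IsPr σ π → ∃[ y ] (π ≡ just y × y ⊆ x) → InfSeq σ x
pr-⊆⇒InfSeq up (y , refl , y⊆x) = Iσ⇒InfSeq (proj₂ (up _) y⊆x)

pr-loop : IsPr σ (just y) → Steps σ y y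
pr-loop {σ = []} up = []
pr-loop {σ = θ ∷ σ} up =
  let sts , I = Iσ-posts (proj₂ (up _) ⊆-refl)
  in Steps-lossy (proj₁ (up _) I) sts

InfSeq⇒Steps-pr : IsPr (θ ∷ σ) π → InfSeq (θ ∷ σ) x →
                  ∃[ y ] (π ≡ just y × Steps (θ ∷ σ) x y)
InfSeq⇒Steps-pr up (g , refl , sts) =
  let y , p≡y , y⊆g₁ = InfSeq⇒pr-⊆ up ((λ i → g (suc i)) , refl , λ i → sts (suc i))
  in y , p≡y , Steps-lossy y⊆g₁ (sts 0)

data Path (Δ : List (Rule k n)) : Fin n → Fin n → List (Rule k n) → Set where
  []   : Path Δ p p []
  cons : ρ ∈ Δ → src ρ ≡ p → Path Δ (tgt ρ) q rs → Path Δ p q (ρ ∷ rs)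

Path-++ : ∀ {W₁ W₂} → Path Δ p m W₁ → Path Δ m q W₂ → Path Δ p q (W₁ ++ W₂)
Path-++ [] path = path
Path-++ (cons ρ∈Δ e path) path′ = cons ρ∈Δ e (Path-++ path path′)

Path-split : ∀ W₁ {W₂} → Path Δ p q (W₁ ++ W₂) → ∃[ m ] (Path Δ p m W₁ × Path Δ m q W₂)
Path-split [] path = _ , [] , path
Path-split (_ ∷ W₁) (cons ρ∈Δ e path) =
  let m , path₁ , path₂ = Path-split W₁ path in m , cons ρ∈Δ e path₁ , path₂

Path-All : Path Δ p q rs → All (_∈ Δ) rs
Path-All [] = []
Path-All (cons ρ∈Δ _ path) = ρ∈Δ ∷ Path-All path

Path-linked : Path Δ p q (r ∷ rs) → Linked (λ a b → tgt a ≡ src b) (r ∷ rs) × tgt (lastOf r rs) ≡ q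
Path-linked (cons _ _ []) = [-] , refl
Path-linked (cons _ _ (cons ρ∈Δ e path)) =
  let linked , closes = Path-linked (cons ρ∈Δ e path) in sym e ∷ linked , closes

Path⇒ElemCycle : Path Δ p p (r ∷ rs) → Unique (map src (r ∷ rs)) → ElemCycle Δ r rs
Path⇒ElemCycle path@(cons _ refl _) distinct = record
  { inΔ      = Path-All path
  ; linked   = proj₁ (Path-linked path)
  ; closes   = proj₂ (Path-linked path)
  ; distinct = distinct
  }

linked⇒Path : ∀ r rs → All (_∈ Δ) (r ∷ rs) → Linked (λ a b → tgt a ≡ src b) (r ∷ rs) →
              Path Δ (src r) (tgt (lastOf r rs)) (r ∷ rs)
linked⇒Path r [] (r∈Δ ∷ []) [-] = cons r∈Δ refl []
linked⇒Path r (s ∷ rs) (r∈Δ ∷ ∈Δ) (e ∷ linked) =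
  cons r∈Δ refl (subst (λ p → Path _ p _ (s ∷ rs)) (sym e) (linked⇒Path s rs ∈Δ linked))

ElemCycle⇒Path : ElemCycle Δ r rs → Path Δ (src r) (src r) (r ∷ rs)
ElemCycle⇒Path {r = r} {rs} c =
  subst (λ q → Path _ (src r) q (r ∷ rs)) closes (linked⇒Path r rs inΔ linked)
  where open ElemCycle c

first-with-src : ∀ p W → p ∈ map src W →
  ∃[ pre ] ∃[ y ] ∃[ post ] (W ≡ pre ++ y ∷ post × src {k} {n} y ≡ p × p ∉ map src pre)
first-with-src p (z ∷ W) p∈ with src z ≟ p
... | yes e = [] , z , W , refl , e , λ ()
first-with-src p (z ∷ W) (here e)   | no z≢p = ⊥-elim (z≢p (sym e))
first-with-src p (z ∷ W) (there p∈) | no z≢p =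
  let pre , y , post , eq , e , p∉ = first-with-src p W p∈
  in z ∷ pre , y , post , cong (z ∷_) eq , e ,
     λ { (here e′) → z≢p (sym e′) ; (there p∈′) → p∉ p∈′ }

record InnerCycle (Δ : List (Rule k n)) (p q : Fin n) (W : List (Rule k n)) : Set where
  constructor innerCycle
  field
    hub            : Fin n
    prefix         : List (Rule k n)
    first next     : Rule k n
    loop suffix    : List (Rule k n)
    split          : W ≡ prefix ++ (first ∷ loop) ++ (next ∷ suffix)
    prefix-path    : Path Δ p hub prefix
    loop-path      : Path Δ hub hub (first ∷ loop)
    loop-distinct  : Unique (map src (first ∷ loop))
    suffix-path    : Path Δ hub q (next ∷ suffix)

distinct-or-inner-cycle : Path Δ p q W → Unique (map src W) ⊎ InnerCycle Δ p q W
distinct-or-inner-cycle [] = inj₁ []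
distinct-or-inner-cycle (cons x∈Δ ex path) with distinct-or-inner-cycle path
... | inj₂ (innerCycle hub prefix first next loop suffix split prefix-path loop-path distinct suffix-path) =
  inj₂ (innerCycle hub (_ ∷ prefix) first next loop suffix (cong (_ ∷_) split)
                   (cons x∈Δ ex prefix-path) loop-path distinct suffix-path)
distinct-or-inner-cycle {W = x ∷ W} (cons x∈Δ refl path) | inj₁ distinct with src x ∈? map src W
  where open DecMembership _≟_
... | no x∉ = inj₁ (¬Any⇒All¬ _ x∉ ∷ distinct)
... | yes x∈ with first-with-src (src x) W x∈
... | pre , y , post , refl , e , x∉pre with Path-split pre path
... | hub , pre-path , suffix-path@(cons _ e′ _) =
  inj₂ (innerCycle (src x) [] x y pre post refl []
                   (cons x∈Δ refl (subst (λ h → Path _ (tgt x) h pre) hub≡x pre-path))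
                   (¬Any⇒All¬ _ x∉pre ∷
                      Unique-++⁻ˡ (map src pre) (subst Unique (map-++ src pre (y ∷ post)) distinct))
                   (subst (λ h → Path _ h _ (y ∷ post)) hub≡x suffix-path))
  where
  hub≡x : hub ≡ src x
  hub≡x = trans (sym e′) e

∈-map-src : ρ ∈ W → src ρ ∈ map src W
∈-map-src = ∈-map⁺ src

length-++-< : ∀ (xs : List A) y ys zs → length (xs ++ zs) < length (xs ++ (y ∷ ys) ++ zs)
length-++-< [] y ys zs = s≤s (length-++-≤ʳ zs {ys})
length-++-< (_ ∷ xs) y ys zs = s≤s (length-++-< xs y ys zs)

first-return-distinct : Flat Δ → Path Δ p p (ρ ∷ W) → All (λ s → src s ≢ p) W →
                        Unique (map src (ρ ∷ W))
first-return-distinct {Δ = Δ} {p = p} flat = go _ ≤-refl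
  where
  go : ∀ N {ρ W} → length W < N → Path Δ p p (ρ ∷ W) → All (λ s → src s ≢ p) W →
       Unique (map src (ρ ∷ W))
  go (suc N) (s≤s lt) path avoid with distinct-or-inner-cycle path
  ... | inj₁ distinct = distinct
  ... | inj₂ (innerCycle _ [] _ next loop suffix refl [] _ _ (cons _ e _)) =
    ⊥-elim (All.lookup avoid (∈-++⁺ʳ loop (here refl)) e)
  ... | inj₂ (innerCycle hub (ρ ∷ prefix) first next loop suffix refl (cons ρ∈Δ eρ prefix-path)
                         loop-path@(cons _ e-first _) loop-distinct suffix-path@(cons _ e-next _)) =
    ⊥-elim (All.lookup avoid (∈-++⁺ʳ prefix (∈-++⁺ˡ ρ∈loop)) eρ)
    where
    shortcut : Path Δ p p (ρ ∷ prefix ++ next ∷ suffix)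
    shortcut = cons ρ∈Δ eρ (Path-++ prefix-path suffix-path)
    shortcut-avoids : All (λ s → src s ≢ p) (prefix ++ next ∷ suffix)
    shortcut-avoids = ++⁺ (++⁻ˡ prefix avoid) (++⁻ʳ (first ∷ loop) (++⁻ʳ prefix avoid))
    outer : ElemCycle Δ ρ (prefix ++ next ∷ suffix)
    outer = Path⇒ElemCycle shortcut
      (go N (≤-trans (length-++-< prefix first loop (next ∷ suffix)) lt) shortcut shortcut-avoids)
    hub∈outer : hub ∈ map src (ρ ∷ prefix ++ next ∷ suffix)
    hub∈outer = subst (_∈ _) e-next (∈-map-src {W = ρ ∷ prefix ++ next ∷ suffix}
                                        (there (∈-++⁺ʳ prefix (here refl))))
    ρ∈loop : ρ ∈ first ∷ loop
    ρ∈loop = proj₁ (flat _ _ _ _ outer (Path⇒ElemCycle loop-path loop-distinct)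
                         hub hub∈outer (here (sym e-first)) ρ) (here refl)

src-injective : Unique (map src C) → ρ ∈ C → r ∈ C → src ρ ≡ src r → ρ ≡ r
src-injective _              (here refl) (here refl) _ = refl
src-injective (ρ∉ ∷ _)        (here refl) (there r∈)  e = ⊥-elim (All.lookup ρ∉ (∈-map-src r∈) e)
src-injective (r∉ ∷ _)        (there ρ∈)  (here refl) e = ⊥-elim (All.lookup r∉ (∈-map-src ρ∈) (sym e))
src-injective (_ ∷ distinct) (there ρ∈)  (there r∈)  e = src-injective distinct ρ∈ r∈ e

Path-deterministic : Unique (map src C) → All (_∈ C) W → All (_∈ C) W′ →
  All (λ s → src s ≢ q) W → All (λ s → src s ≢ q) W′ → Path Δ p q W → Path Δ p q W′ → W ≡ W′
Path-deterministic _ _ _ _ _ [] [] = refl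
Path-deterministic _ _ _ _ (avoid ∷ _) [] (cons _ e _) = ⊥-elim (avoid e)
Path-deterministic _ _ _ (avoid ∷ _) _ (cons _ e _) [] = ⊥-elim (avoid e)
Path-deterministic distinct (ρ∈ ∷ ∈C) (r∈ ∷ ∈C′) (_ ∷ avoid) (_ ∷ avoid′)
                   (cons _ e path) (cons _ e′ path′)
  with src-injective distinct ρ∈ r∈ (trans e (sym e′))
... | refl = cong (_ ∷_) (Path-deterministic distinct ∈C ∈C′ avoid avoid′ path path′)

Path-tail : Path Δ p q (ρ ∷ W) → Path Δ (tgt ρ) q W
Path-tail (cons _ _ path) = path

ElemCycle-avoids : ElemCycle Δ r rs → All (λ s → src s ≢ src r) rs
ElemCycle-avoids c with ElemCycle.distinct c
... | r∉ ∷ _ = All.map (λ ne e → ne (sym e)) (map⁻ r∉)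

ElemCycle-≡ : ElemCycle Δ r rs → ElemCycle Δ r′ rs′ → src r ≡ src r′ →
              (∀ ρ → ρ ∈ r′ ∷ rs′ → ρ ∈ r ∷ rs) → r ∷ rs ≡ r′ ∷ rs′
ElemCycle-≡ c c′ e ⊆c with src-injective (ElemCycle.distinct c) (here refl) (⊆c _ (here refl)) e
... | refl = cong (_ ∷_) (Path-deterministic (ElemCycle.distinct c)
  (All.tabulate there) (All.tabulate (λ ρ∈ → ⊆c _ (there ρ∈)))
  (ElemCycle-avoids c) (ElemCycle-avoids c′)
  (Path-tail (ElemCycle⇒Path c)) (Path-tail (ElemCycle⇒Path c′)))

flat-cycle-unique : Flat Δ → ElemCycleAt Δ q r rs → ElemCycleAt Δ q r′ rs′ → r ∷ rs ≡ r′ ∷ rs′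
flat-cycle-unique flat (c , e) (c′ , e′) = ElemCycle-≡ c c′ (trans e (sym e′))
  (λ ρ → proj₂ (flat _ _ _ _ c c′ _ (here (sym e)) (here (sym e′)) ρ))

Path-Reach : Path Δ p q W → Steps (map act W) u v → Reach Δ (p , u) (q , v)
Path-Reach [] [] = ε
Path-Reach (cons ρ∈Δ refl path) (st ∷ sts) = step ρ∈Δ st ◅ Path-Reach path sts

Path-Reach⁺ : Path Δ p q (ρ ∷ W) → Steps (map act (ρ ∷ W)) u v →
              ∃[ c ] (Step Δ (p , u) c × Reach Δ c (q , v))
Path-Reach⁺ (cons ρ∈Δ refl path) (st ∷ sts) = _ , step ρ∈Δ st , Path-Reach path sts

ElemCycleAt⇒Path : ∀ {r rs} → ElemCycleAt Δ q r rs → Path Δ q q (r ∷ rs)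
ElemCycleAt⇒Path (c , refl) = ElemCycle⇒Path c

IsRun : List (Rule k n) → (ℕ → Config k n) → Set
IsRun Δ f = ∀ i → Step Δ (f i) (f (suc i))

module _ {k n : ℕ} {Δ : List (Rule k n)} where

  private
    variable
      c c′ : Config k n

  rule : Step Δ c c′ → Rule k n
  rule (step {p} {θ} {p″} _ _) = p , θ , p″

  rule-src : (s : Step Δ c c′) → src (rule s) ≡ proj₁ c
  rule-src (step _ _) = refl

  Step-cons : (s : Step Δ c c′) → Path Δ (proj₁ c′) q W → Path Δ (proj₁ c) q (rule s ∷ W)
  Step-cons (step ρ∈Δ _) path = cons ρ∈Δ refl path

  Step-chan : (s : Step Δ c c′) → ChanStep (act (rule s)) (proj₂ c) (proj₂ c′)
  Step-chan (step _ st) = st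

  IsRun-Reach : ∀ {f} → IsRun Δ f → ∀ j → Reach Δ (f 0) (f j)
  IsRun-Reach h zero    = ε
  IsRun-Reach h (suc j) = h 0 ◅ IsRun-Reach (λ i → h (suc i)) j

  window : ∀ {f} → IsRun Δ f → ℕ → List (Rule k n)
  window h zero    = []
  window h (suc d) = rule (h 0) ∷ window (λ i → h (suc i)) d

  window-path : ∀ {f} (h : IsRun Δ f) → ∀ d → Path Δ (proj₁ (f 0)) (proj₁ (f d)) (window h d)
  window-path h zero    = []
  window-path h (suc d) = Step-cons (h 0) (window-path (λ i → h (suc i)) d)

  window-steps : ∀ {f} (h : IsRun Δ f) → ∀ d →
                 Steps (map act (window h d)) (proj₂ (f 0)) (proj₂ (f d))
  window-steps h zero    = []
  window-steps h (suc d) = Step-chan (h 0) ∷ window-steps (λ i → h (suc i)) d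

  window-All : ∀ {f} {P : Rule k n → Set} (h : IsRun Δ f) → ∀ d → (∀ {u} → u < d → P (rule (h u))) →
               All P (window h d)
  window-All h zero    _   = []
  window-All h (suc d) all = all (s≤s z≤n) ∷ window-All (λ i → h (suc i)) d (λ u<d → all (s≤s u<d))

module RecurrentRun {k n : ℕ} {Δ : List (Rule k n)} (flat : Flat Δ)
                    {f : ℕ → Config k n} (h : IsRun Δ f)
                    {q : Fin n} (often : ∀ i → ∃[ j ] (i ≤ j × proj₁ (f j) ≡ q)) where

  next-visit : ∀ a → ∃[ e ] (proj₁ (f (suc e + a)) ≡ q ×
                             (∀ {u} → u < e → proj₁ (f (suc u + a)) ≢ q))
  next-visit a =
    let j , a<j , fj≡q = often (suc a)
    in least-witness (λ u → proj₁ (f (suc u + a)) ≟ q) (j ∸ suc a)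
         (subst (λ t → proj₁ (f t) ≡ q) (trans (sym (m∸n+n≡m a<j)) (+-suc (j ∸ suc a) a)) fj≡q)

  visit : ℕ → ℕ
  gap : ℕ → ℕ
  visit zero    = proj₁ (often 0)
  visit (suc m) = suc (gap m) + visit m
  gap m = proj₁ (next-visit (visit m))

  at-visit : ∀ m → proj₁ (f (visit m)) ≡ q
  at-visit zero    = proj₂ (proj₂ (often 0))
  at-visit (suc m) = proj₁ (proj₂ (next-visit (visit m)))

  shifted : ∀ m → IsRun Δ (λ i → f (i + visit m))
  shifted m i = h (i + visit m)

  excursion : ℕ → List (Rule k n)
  excursion m = window (shifted m) (suc (gap m))

  excursion-cycle : ∀ m → ElemCycleAt Δ q (rule (h (visit m))) (window (λ i → shifted m (suc i)) (gap m))
  excursion-cycle m = Path⇒ElemCycle path (first-return-distinct flat path avoids) ,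
                      trans (rule-src (h (visit m))) (at-visit m)
    where
    path : Path Δ q q (excursion m)
    path = subst₂ (λ p p′ → Path Δ p p′ (excursion m)) (at-visit m) (at-visit (suc m))
                  (window-path (shifted m) (suc (gap m)))
    avoids : All (λ s → src s ≢ q) (window (λ i → shifted m (suc i)) (gap m))
    avoids = window-All (λ i → shifted m (suc i)) (gap m)
               (λ {u} u<gap e → proj₂ (proj₂ (next-visit (visit m))) u<gap
                                  (trans (sym (rule-src (h (suc u + visit m)))) e))

  excursion-steps : ∀ m → Steps (map act (excursion 0)) (proj₂ (f (visit m))) (proj₂ (f (visit (suc m))))
  excursion-steps m =
    subst (λ W → Steps (map act W) (proj₂ (f (visit m))) (proj₂ (f (visit (suc m)))))
          (flat-cycle-unique flat (excursion-cycle m) (excursion-cycle 0))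
          (window-steps (shifted m) (suc (gap m)))

  recurrent-cycle : ∃[ r ] ∃[ rs ] (ElemCycleAt Δ q r rs ×
                      ∃[ z ] (Reach Δ (f 0) (q , z) × InfSeq (cycleWord r rs) z))
  recurrent-cycle =
    _ , _ , excursion-cycle 0 , proj₂ (f (visit 0)) ,
    subst (λ p → Reach Δ (f 0) (p , proj₂ (f (visit 0)))) (at-visit 0) (IsRun-Reach h (visit 0)) ,
    (λ m → proj₂ (f (visit m))) , refl , excursion-steps

CycleLimitReachable : (List (Action k) → Maybe (List (Fin k))) →
                      List (Rule k n) → Config k n → Fin n → Set
CycleLimitReachable pr Δ c q =
  ∃[ r ] ∃[ rs ] (ElemCycleAt Δ q r rs × ∃[ y ] (pr (cycleWord r rs) ≡ just y × Reach Δ c (q , y)))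

module _ {k : ℕ} {pr : List (Action k) → Maybe (List (Fin k))} (pr-spec : ∀ σ → IsPr σ (pr σ))
         {n : ℕ} {Δ : List (Rule k n)} {c : Config k n} {q : Fin n} where

  recurrent⇒CycleLimitReachable : Flat Δ → InfRunVisiting Δ c q → CycleLimitReachable pr Δ c q
  recurrent⇒CycleLimitReachable flat (f , refl , h , often) =
    let r , rs , cyc , z , reach , inf = RecurrentRun.recurrent-cycle flat h often
        y , pr≡y , sts = InfSeq⇒Steps-pr (pr-spec _) inf
    in r , rs , cyc , y , pr≡y , reach ◅◅ Path-Reach (ElemCycleAt⇒Path cyc) sts

  CycleLimitReachable⇒recurrent : CycleLimitReachable pr Δ c q → InfRunVisiting Δ c q
  CycleLimitReachable⇒recurrent (r , rs , cyc , y , pr≡y , reach) =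
    let _ , edge , back = Path-Reach⁺ (ElemCycleAt⇒Path cyc)
                            (pr-loop (subst (IsPr (cycleWord r rs)) pr≡y (pr-spec _)))
        f , f0 , h , visits = lasso reach edge back
    in f , f0 , h , λ i → let j , i≤j , e = visits i in j , i≤j , cong proj₁ e

lemma18 : ∀ {k : ℕ} (pr : List (Action k) → Maybe (List (Fin k)))
    → (∀ σ → IsPr σ (pr σ))
    → (∀ (σ : List (Action k)) (x : List (Fin k))
         → (InfSeq σ x → ∃[ y ] (pr σ ≡ just y × y ⊆ x))
         × (∃[ y ] (pr σ ≡ just y × y ⊆ x) → InfSeq σ x))
    × (∀ {n : ℕ} (Δ : List (Rule k n)) → Flat Δ
         → ∀ (q : Fin n) (x : List (Fin k)) (q' : Fin n)
         → (InfRunVisiting Δ (q , x) q'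
             → ∃[ r ] ∃[ rs ] (ElemCycleAt Δ q' r rs
                 × ∃[ y ] (pr (cycleWord r rs) ≡ just y × Reach Δ (q , x) (q' , y))))
         × (∃[ r ] ∃[ rs ] (ElemCycleAt Δ q' r rs
                 × ∃[ y ] (pr (cycleWord r rs) ≡ just y × Reach Δ (q , x) (q' , y)))
             → InfRunVisiting Δ (q , x) q'))
lemma18 pr pr-spec =
  (λ σ x → InfSeq⇒pr-⊆ (pr-spec σ) , pr-⊆⇒InfSeq (pr-spec σ)) ,
  (λ Δ flat q x q′ → recurrent⇒CycleLimitReachable pr-spec flat , CycleLimitReachable⇒recurrent pr-spec)
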